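{- Let $G$ be a graph and let $u,v$ be adjacent vertices with $N[u]=N[v]$ (i.e., $u$ and $v$ are adjacent twins). Then $\mathcal{M}_1(G)\le \mathcal{M}_1(G - uv)$, where $G-uv$ denotes the graph obtained from $G$ by deleting the edge $uv$.
   Context: Graphs are finite, simple and undirected. For a graph $G$, $\mathcal{M}_1(G)$ denotes the number of inclusion-maximal sets $S\subseteq V(G)$ such that $G[S]$ has maximum degree at most $1$. $N[x]$ denotes the closed neighborhood of $x$. -}

module Defs where

open import Data.Nat using (ℕ; zero; suc; _≤ᵇ_)
open import Data.Bool using (Bool; true; false; _∧_; _∨_; not; if_then_else_)
open import Data.Fin using (Fin; zero; suc; _≟_)
open import Data.Vec using (Vec; []; _∷_; lookup)
open import Data.List using (List; []; _∷_; map; _++_; allFin)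
open import Relation.Nullary.Decidable using (⌊_⌋)
open import Relation.Binary.PropositionalEquality using (_≡_)

-- A (finite, simple, undirected) graph on vertex set Fin n is given by a
-- Boolean adjacency function; simplicity/undirectedness are the hypotheses
-- Symmetric and Irreflexive below.
Adj : ℕ → Set
Adj n = Fin n → Fin n → Bool

Symmetric : ∀ {n} → Adj n → Set
Symmetric {n} A = (x y : Fin n) → A x y ≡ A y x

Irreflexive : ∀ {n} → Adj n → Set
Irreflexive {n} A = (x : Fin n) → A x x ≡ false

VSet : ℕ → Set
VSet n = Vec Bool n

allB : ∀ {a} {X : Set a} → (X → Bool) → List X → Bool
allB p [] = true
allB p (x ∷ xs) = p x ∧ allB p xs

countB : ∀ {a} {X : Set a} → (X → Bool) → List X → ℕ
countB p [] = 0
countB p (x ∷ xs) = if p x then suc (countB p xs) else countB p xs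

allSubsets : (n : ℕ) → List (VSet n)
allSubsets zero = [] ∷ []
allSubsets (suc n) = map (false ∷_) (allSubsets n) ++ map (true ∷_) (allSubsets n)

_==_ : ∀ {n} → Fin n → Fin n → Bool
x == y = ⌊ x ≟ y ⌋

_∈ₛ_ : ∀ {n} → Fin n → VSet n → Bool
x ∈ₛ S = lookup S x

_⊆ₛ_ : ∀ {n} → VSet n → VSet n → Bool
_⊆ₛ_ {n} S T = allB (λ x → not (x ∈ₛ S) ∨ (x ∈ₛ T)) (allFin n)

_≡ₛ_ : ∀ {n} → VSet n → VSet n → Bool
S ≡ₛ T = (S ⊆ₛ T) ∧ (T ⊆ₛ S)

degIn : ∀ {n} → Adj n → VSet n → Fin n → ℕ
degIn {n} A S v = countB (λ w → (w ∈ₛ S) ∧ A v w) (allFin n)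

maxDeg≤1 : ∀ {n} → Adj n → VSet n → Bool
maxDeg≤1 {n} A S = allB (λ v → not (v ∈ₛ S) ∨ (degIn A S v ≤ᵇ 1)) (allFin n)

isMaximal1 : ∀ {n} → Adj n → VSet n → Bool
isMaximal1 {n} A S =
  maxDeg≤1 A S ∧
  allB (λ T → not ((S ⊆ₛ T) ∧ maxDeg≤1 A T) ∨ (T ≡ₛ S)) (allSubsets n)

M1 : ∀ {n} → Adj n → ℕ
M1 {n} A = countB (isMaximal1 A) (allSubsets n)

inClosedNbhd : ∀ {n} → Adj n → Fin n → Fin n → Bool
inClosedNbhd A x w = (x == w) ∨ A x w

deleteEdge : ∀ {n} → Adj n → Fin n → Fin n → Adj n
deleteEdge A u v x y = A x y ∧ not (((x == u) ∧ (y == v)) ∨ ((x == v) ∧ (y == u)))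

-- Deleting the edge uv does not change which sets S induce a subgraph of
-- maximum degree at most 1, so the two graphs have the same maximal such sets.
-- Only the direction "Δ((G - uv)[S]) ≤ 1 ⇒ Δ(G[S]) ≤ 1" needs the twins: if
-- u, v ∈ S and u had a further neighbour z in S, then z ∈ N[v] as well, and z
-- would have the two neighbours u and v in (G - uv)[S].
module Submission where

open import Defs
open import Data.Bool using (Bool; true; false; _∧_; _∨_; not)
open import Data.Bool.Properties using (∧-conicalˡ; ∧-conicalʳ; ∧-identityʳ; ∨-zeroʳ; T-≡)
open import Data.Empty using (⊥-elim)
open import Data.Fin using (Fin; zero; suc; _≟_)
open import Data.Fin.Properties using (suc-injective)
open import Data.List using (List; []; _∷_; tabulate)
open import Data.Nat using (ℕ; zero; suc; _≤_; _≤ᵇ_; z≤n; s≤s; s≤s⁻¹)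
open import Data.Nat.Properties
  using (n≤0⇒n≡0; n≤1+n; ≤-refl; ≤-trans; ≤-reflexive; ≤ᵇ⇒≤; ≤⇒≤ᵇ)
open import Data.Product using (_×_; _,_)
open import Data.Sum using (_⊎_; inj₁; inj₂)
open import Function using (_∘_; id; Equivalence)
open import Relation.Nullary using (yes; no; contradiction)
open import Relation.Nullary.Decidable using (dec-false; isYes≗does; toWitness)
open import Relation.Binary.PropositionalEquality
  using (_≡_; _≢_; refl; sym; trans; cong; cong₂; subst)

private
  variable
    n : ℕ
    X : Set

∧-intro : ∀ {a b} → a ≡ true → b ≡ true → a ∧ b ≡ true
∧-intro refl refl = refl

implies-intro : ∀ {a b} → (a ≡ true → b ≡ true) → not a ∨ b ≡ true
implies-intro {true}  f = f refl
implies-intro {false} f = refl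

implies-elim : ∀ {a b} → not a ∨ b ≡ true → a ≡ true → b ≡ true
implies-elim h refl = h

≡true⇔⇒≡ : ∀ {a b} → (a ≡ true → b ≡ true) → (b ≡ true → a ≡ true) → a ≡ b
≡true⇔⇒≡ {true}  {true}  f g = refl
≡true⇔⇒≡ {true}  {false} f g = sym (f refl)
≡true⇔⇒≡ {false} {true}  f g = g refl
≡true⇔⇒≡ {false} {false} f g = refl

true≢false : true ≢ false
true≢false ()

==⇒≡ : {x y : Fin n} → (x == y) ≡ true → x ≡ y
==⇒≡ h = toWitness (Equivalence.from T-≡ h)

≢⇒==false : {x y : Fin n} → x ≢ y → (x == y) ≡ false
≢⇒==false {x = x} {y} x≢y = trans (isYes≗does (x ≟ y)) (dec-false (x ≟ y) x≢y)

allB-cong : {p q : X → Bool} → (∀ x → p x ≡ q x) → ∀ xs → allB p xs ≡ allB q xs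
allB-cong p≗q []       = refl
allB-cong p≗q (x ∷ xs) = cong₂ _∧_ (p≗q x) (allB-cong p≗q xs)

countB-cong : {p q : X → Bool} → (∀ x → p x ≡ q x) → ∀ xs → countB p xs ≡ countB q xs
countB-cong p≗q []       = refl
countB-cong p≗q (x ∷ xs) rewrite p≗q x | countB-cong p≗q xs = refl

allB-tabulate⁻ : (p : X → Bool) (g : Fin n → X) →
                 allB p (tabulate g) ≡ true → ∀ i → p (g i) ≡ true
allB-tabulate⁻ p g h zero    = ∧-conicalˡ _ _ h
allB-tabulate⁻ p g h (suc i) = allB-tabulate⁻ p (g ∘ suc) (∧-conicalʳ _ _ h) i

allB-tabulate⁺ : (p : X → Bool) (g : Fin n → X) →
                 (∀ i → p (g i) ≡ true) → allB p (tabulate g) ≡ true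
allB-tabulate⁺ {n = zero}  p g h = refl
allB-tabulate⁺ {n = suc n} p g h = ∧-intro (h zero) (allB-tabulate⁺ p (g ∘ suc) (h ∘ suc))

countB-tabulate≡0⁻ : (p : X → Bool) (g : Fin n → X) →
                     countB p (tabulate g) ≡ 0 → ∀ i → p (g i) ≡ false
countB-tabulate≡0⁻ {n = suc n} p g h i with p (g zero) in g₀
countB-tabulate≡0⁻ p g () i       | true
countB-tabulate≡0⁻ p g h zero    | false = g₀
countB-tabulate≡0⁻ p g h (suc i) | false = countB-tabulate≡0⁻ p (g ∘ suc) h i

countB-tabulate≡0⁺ : (p : X → Bool) (g : Fin n → X) →
                     (∀ i → p (g i) ≡ false) → countB p (tabulate g) ≡ 0
countB-tabulate≡0⁺ {n = zero}  p g h = refl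
countB-tabulate≡0⁺ {n = suc n} p g h rewrite h zero =
  countB-tabulate≡0⁺ p (g ∘ suc) (h ∘ suc)

AtMostOne : (Fin n → Bool) → Set
AtMostOne {n} q = (i j : Fin n) → q i ≡ true → q j ≡ true → i ≡ j

countB-∷-≤ : (p : X → Bool) (x : X) (xs : List X) → countB p xs ≤ countB p (x ∷ xs)
countB-∷-≤ p x xs with p x
... | true  = n≤1+n (countB p xs)
... | false = ≤-refl

countB-∷≤1-head⇒tail : (p : X → Bool) (x : X) (xs : List X) →
                       countB p (x ∷ xs) ≤ 1 → p x ≡ true → countB p xs ≡ 0
countB-∷≤1-head⇒tail p x xs h px rewrite px = n≤0⇒n≡0 (s≤s⁻¹ h)

countB-tabulate≤1⇒AtMostOne : (p : X → Bool) (g : Fin n → X) →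
                              countB p (tabulate g) ≤ 1 → AtMostOne (p ∘ g)
countB-tabulate≤1⇒AtMostOne p g h zero zero _ _ = refl
countB-tabulate≤1⇒AtMostOne p g h zero (suc j) p₀ pj =
  contradiction (trans (sym pj) (countB-tabulate≡0⁻ p (g ∘ suc) tail≡0 j)) true≢false
  where
  tail≡0 : countB p (tabulate (g ∘ suc)) ≡ 0
  tail≡0 = countB-∷≤1-head⇒tail p (g zero) (tabulate (g ∘ suc)) h p₀
countB-tabulate≤1⇒AtMostOne p g h (suc i) zero pi p₀ =
  sym (countB-tabulate≤1⇒AtMostOne p g h zero (suc i) p₀ pi)
countB-tabulate≤1⇒AtMostOne p g h (suc i) (suc j) pi pj =
  cong suc (countB-tabulate≤1⇒AtMostOne p (g ∘ suc) tail≤1 i j pi pj)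
  where
  tail≤1 : countB p (tabulate (g ∘ suc)) ≤ 1
  tail≤1 = ≤-trans (countB-∷-≤ p (g zero) (tabulate (g ∘ suc))) h

AtMostOne-head⇒tail : {q : Fin (suc n) → Bool} →
                      AtMostOne q → q zero ≡ true → ∀ i → q (suc i) ≡ false
AtMostOne-head⇒tail {q = q} h q₀ i with q (suc i) in qᵢ
... | true  = contradiction (h zero (suc i) q₀ qᵢ) λ ()
... | false = refl

AtMostOne⇒countB-tabulate≤1 : (p : X → Bool) (g : Fin n → X) →
                              AtMostOne (p ∘ g) → countB p (tabulate g) ≤ 1
AtMostOne⇒countB-tabulate≤1 {n = zero}  p g h = z≤n
AtMostOne⇒countB-tabulate≤1 {n = suc n} p g h with p (g zero) in g₀
... | true  rewrite countB-tabulate≡0⁺ p (g ∘ suc) (AtMostOne-head⇒tail h g₀) = s≤s z≤n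
... | false = AtMostOne⇒countB-tabulate≤1 p (g ∘ suc)
                (λ i j pi pj → suc-injective (h (suc i) (suc j) pi pj))

≤ᵇ1⇒≤1 : ∀ {c} → (c ≤ᵇ 1) ≡ true → c ≤ 1
≤ᵇ1⇒≤1 {c} h = ≤ᵇ⇒≤ c 1 (Equivalence.from T-≡ h)

≤1⇒≤ᵇ1 : ∀ {c} → c ≤ 1 → (c ≤ᵇ 1) ≡ true
≤1⇒≤ᵇ1 h = Equivalence.to T-≡ (≤⇒≤ᵇ h)

MaxDeg≤1 : Adj n → VSet n → Set
MaxDeg≤1 A S = ∀ {y x z} → y ∈ₛ S ≡ true → x ∈ₛ S ≡ true → z ∈ₛ S ≡ true →
               A y x ≡ true → A y z ≡ true → x ≡ z

maxDeg≤1⇒MaxDeg≤1 : (A : Adj n) (S : VSet n) → maxDeg≤1 A S ≡ true → MaxDeg≤1 A S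
maxDeg≤1⇒MaxDeg≤1 A S h {y} {x} {z} yS xS zS yx yz =
  countB-tabulate≤1⇒AtMostOne (λ w → (w ∈ₛ S) ∧ A y w) id
    (≤ᵇ1⇒≤1 (implies-elim (allB-tabulate⁻ _ id h y) yS))
    x z (∧-intro xS yx) (∧-intro zS yz)

MaxDeg≤1⇒maxDeg≤1 : (A : Adj n) (S : VSet n) → MaxDeg≤1 A S → maxDeg≤1 A S ≡ true
MaxDeg≤1⇒maxDeg≤1 A S h =
  allB-tabulate⁺ (λ y → not (y ∈ₛ S) ∨ (degIn A S y ≤ᵇ 1)) id λ y → implies-intro λ yS →
  ≤1⇒≤ᵇ1 (AtMostOne⇒countB-tabulate≤1 _ id λ x z yx yz →
    h yS (∧-conicalˡ _ _ yx) (∧-conicalˡ _ _ yz) (∧-conicalʳ _ _ yx) (∧-conicalʳ _ _ yz))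

MaxDeg≤1-antimono : {A B : Adj n} {S : VSet n} → (∀ p q → B p q ≡ true → A p q ≡ true) →
                    MaxDeg≤1 A S → MaxDeg≤1 B S
MaxDeg≤1-antimono B⊆A h yS xS zS yx yz = h yS xS zS (B⊆A _ _ yx) (B⊆A _ _ yz)

isMaximal1-cong : {A B : Adj n} → (∀ S → maxDeg≤1 A S ≡ maxDeg≤1 B S) →
                  ∀ S → isMaximal1 A S ≡ isMaximal1 B S
isMaximal1-cong {n} same S = cong₂ _∧_ (same S)
  (allB-cong (λ T → cong (λ b → not ((S ⊆ₛ T) ∧ b) ∨ (T ≡ₛ S)) (same T)) (allSubsets n))

M1-cong : {A B : Adj n} → (∀ S → maxDeg≤1 A S ≡ maxDeg≤1 B S) → M1 A ≡ M1 B
M1-cong {n} same = countB-cong (isMaximal1-cong same) (allSubsets n)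

record Twins (A : Adj n) (a b : Fin n) : Set where
  constructor twins
  field closedNbhd-≡ : ∀ w → inClosedNbhd A a w ≡ inClosedNbhd A b w

Twins-sym : {A : Adj n} {a b : Fin n} → Twins A a b → Twins A b a
Twins-sym (twins tw) = twins (sym ∘ tw)

Twins-adj : {A : Adj n} {a b z : Fin n} → Twins A a b → A a z ≡ true → z ≢ b → A b z ≡ true
Twins-adj {A = A} {a} {b} {z} (twins tw) az z≢b =
  subst (λ c → c ∨ A b z ≡ true) (≢⇒==false (z≢b ∘ sym))
    (trans (sym (tw z)) (trans (cong ((a == z) ∨_) az) (∨-zeroʳ (a == z))))

module _ (A : Adj n) (u v : Fin n) where

  deleteEdge-⊆ : ∀ p q → deleteEdge A u v p q ≡ true → A p q ≡ true
  deleteEdge-⊆ p q = ∧-conicalˡ _ _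

  deleteEdge-away : ∀ {p q} → p ≢ u → p ≢ v → deleteEdge A u v p q ≡ A p q
  deleteEdge-away {p} {q} p≢u p≢v
    rewrite ≢⇒==false p≢u | ≢⇒==false p≢v = ∧-identityʳ (A p q)

  deleteEdge-removed : ∀ {p q} → A p q ≡ true → deleteEdge A u v p q ≡ false →
                       (p ≡ u × q ≡ v) ⊎ (p ≡ v × q ≡ u)
  deleteEdge-removed {p} {q} pq removed
    with (p == u) ∧ (q == v) in e₁ | (p == v) ∧ (q == u) in e₂
  ... | true  | _    = inj₁ (==⇒≡ (∧-conicalˡ _ _ e₁) , ==⇒≡ (∧-conicalʳ _ _ e₁))
  ... | false | true = inj₂ (==⇒≡ (∧-conicalˡ _ _ e₂) , ==⇒≡ (∧-conicalʳ _ _ e₂))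
  ... | false | false =
    contradiction (trans (sym pq) (trans (sym (∧-identityʳ (A p q))) removed)) true≢false

module _ {A : Adj n} (symm : Symmetric A) (irr : Irreflexive A) where

  adj⇒≢ : ∀ {p q} → A p q ≡ true → p ≢ q
  adj⇒≢ {p} pq refl = true≢false (trans (sym pq) (irr p))

  Twins-edge-isolated : {B : Adj n} {S : VSet n} {a b z : Fin n} → Twins A a b →
                        (∀ {p q} → p ≢ a → p ≢ b → B p q ≡ A p q) → MaxDeg≤1 B S →
                        a ∈ₛ S ≡ true → b ∈ₛ S ≡ true → z ∈ₛ S ≡ true →
                        A a b ≡ true → A a z ≡ true → b ≡ z
  Twins-edge-isolated {B} {S} {a} {b} {z} tw agree md aS bS zS ab az with z ≟ b
  ... | yes z≡b = sym z≡b
  ... | no  z≢b = ⊥-elim (adj⇒≢ ab (md zS aS bS Bza Bzb))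
    where
    z≢a : z ≢ a
    z≢a = adj⇒≢ az ∘ sym

    Bza : B z a ≡ true
    Bza = trans (agree z≢a z≢b) (trans (symm z a) az)

    Bzb : B z b ≡ true
    Bzb = trans (agree z≢a z≢b) (trans (symm z b) (Twins-adj tw az z≢b))

  module _ {u v : Fin n} {S : VSet n} (tw : Twins A u v)
           (md : MaxDeg≤1 (deleteEdge A u v) S) where

    deletedEdge-isolated : ∀ {y x z} → deleteEdge A u v y x ≡ false →
                           y ∈ₛ S ≡ true → x ∈ₛ S ≡ true → z ∈ₛ S ≡ true →
                           A y x ≡ true → A y z ≡ true → x ≡ z
    deletedEdge-isolated removed yS xS zS yx yz with deleteEdge-removed A u v yx removed
    ... | inj₁ (refl , refl) =
      Twins-edge-isolated {S = S} tw (deleteEdge-away A u v) md yS xS zS yx yz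
    ... | inj₂ (refl , refl) =
      Twins-edge-isolated {S = S} (Twins-sym tw) (λ p≢v p≢u → deleteEdge-away A u v p≢u p≢v)
        md yS xS zS yx yz

    MaxDeg≤1-deleteEdge-twins : MaxDeg≤1 A S
    MaxDeg≤1-deleteEdge-twins {y} {x} {z} yS xS zS yx yz
      with deleteEdge A u v y x in e₁ | deleteEdge A u v y z in e₂
    ... | true  | true  = md yS xS zS e₁ e₂
    ... | false | _     = deletedEdge-isolated e₁ yS xS zS yx yz
    ... | true  | false = sym (deletedEdge-isolated e₂ yS zS xS yz yx)

  maxDeg≤1-deleteEdge-twins : {u v : Fin n} → Twins A u v →
                              ∀ S → maxDeg≤1 A S ≡ maxDeg≤1 (deleteEdge A u v) S
  maxDeg≤1-deleteEdge-twins {u} {v} tw S = ≡true⇔⇒≡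
    (MaxDeg≤1⇒maxDeg≤1 _ S
      ∘ MaxDeg≤1-antimono {S = S} (deleteEdge-⊆ A u v)
      ∘ maxDeg≤1⇒MaxDeg≤1 A S)
    (MaxDeg≤1⇒maxDeg≤1 A S
      ∘ MaxDeg≤1-deleteEdge-twins {S = S} tw
      ∘ maxDeg≤1⇒MaxDeg≤1 _ S)

-- The adjacency hypothesis is unused: the argument works for any closed twins.
lemma27 : (n : ℕ) (A : Adj n) → Symmetric A → Irreflexive A →
          (u v : Fin n) → A u v ≡ true →
          ((w : Fin n) → inClosedNbhd A u w ≡ inClosedNbhd A v w) →
          M1 A ≤ M1 (deleteEdge A u v)
lemma27 n A symm irr u v _ tw =
  ≤-reflexive (M1-cong (maxDeg≤1-deleteEdge-twins symm irr (twins tw)))
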